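{- Let $S\subseteq \mathbb{N}^d$ be a generalized numerical semigroup whose hole set $H(S)$ has exactly two maximal elements $\mathbf{h}_1,\mathbf{h}_2$ with respect to the natural partial order on $\mathbb{N}^d$. Then both $\mathbf{h}_1$ and $\mathbf{h}_2$ are Frobenius allowable.
   Context: A generalized numerical semigroup (GNS) is a submonoid $S\subseteq\mathbb{N}^d$ such that $H(S)=\mathbb{N}^d\setminus S$ is finite. Natural partial order: $\mathbf{x}\le\mathbf{y}$ iff $x^{(i)}\le y^{(i)}$ for all $i$. A relaxed monomial order is a total order $\prec$ on $\mathbb{N}^d$ such that (i) if $\mathbf{v}\prec\mathbf{w}$ then $\mathbf{v}\prec\mathbf{w}+\mathbf{u}$ for every $\mathbf{u}\in\mathbb{N}^d$, and (ii) $\mathbf{0}\prec\mathbf{v}$ for every nonzero $\mathbf{v}$. The Frobenius element $\mathbf{F}_{\prec}$ of $S$ with respect to $\prec$ is the $\prec$-largest element of $H(S)$. An element $\mathbf{h}\in H(S)$ is Frobenius allowable if there exists a relaxed monomial order $\prec$ with $\mathbf{F}_{\prec}=\mathbf{h}$. -}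

module Defs where

open import Data.Nat using (ℕ; _+_; _≤_)
open import Data.Vec using (Vec; replicate; zipWith)
open import Data.Vec.Relation.Binary.Pointwise.Inductive using (Pointwise)
open import Data.Product using (_×_; Σ; ∃)
open import Data.Sum using (_⊎_)
open import Data.Empty using (⊥)
open import Relation.Nullary using (¬_)
open import Relation.Binary.PropositionalEquality using (_≡_; _≢_)
open import Relation.Binary.Definitions using (Trichotomous)
open import Data.List using (List)
open import Data.List.Membership.Propositional using (_∈_)
open import Level using (0ℓ; suc)

Pt : ℕ → Set
Pt d = Vec ℕ d

𝟎 : ∀ {d} → Pt d
𝟎 {d} = replicate d 0

_⊕_ : ∀ {d} → Pt d → Pt d → Pt d
_⊕_ = zipWith _+_

_≤ₙ_ : ∀ {d} → Pt d → Pt d → Set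
_≤ₙ_ = Pointwise _≤_

record IsGNS {d : ℕ} (S : Pt d → Set) : Set where
  field
    zero∈ : S 𝟎
    closed : ∀ x y → S x → S y → S (x ⊕ y)
    finiteHoles : ∃ λ (L : List (Pt d)) → ∀ x → ¬ S x → x ∈ L

Hole : ∀ {d} → (Pt d → Set) → Pt d → Set
Hole S x = ¬ S x

IsMaximalHole : ∀ {d} → (Pt d → Set) → Pt d → Set
IsMaximalHole S h = Hole S h × (∀ x → Hole S x → h ≤ₙ x → x ≡ h)

record IsRelaxedMonomialOrder {d : ℕ} (_≺_ : Pt d → Pt d → Set) : Set where
  field
    irrefl : ∀ x → ¬ (x ≺ x)
    trans : ∀ x y z → x ≺ y → y ≺ z → x ≺ z
    total : ∀ x y → x ≺ y ⊎ x ≡ y ⊎ y ≺ x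
    monotone : ∀ v w u → v ≺ w → v ≺ (w ⊕ u)
    zero-least : ∀ v → v ≢ 𝟎 → 𝟎 ≺ v

IsFrobenius : ∀ {d} → (Pt d → Set) → (Pt d → Pt d → Set) → Pt d → Set
IsFrobenius S _≺_ F = Hole S F × (∀ x → Hole S x → x ≢ F → x ≺ F)

FrobeniusAllowable : ∀ {d} → (Pt d → Set) → Pt d → Set₁
FrobeniusAllowable {d} S h =
  Hole S h × Σ (Pt d → Pt d → Set) λ _≺_ → IsRelaxedMonomialOrder _≺_ × IsFrobenius S _≺_ h

module Submission where

-- Every maximal hole of a subset S ⊆ ℕ^d is Frobenius allowable; the
-- theorem is the special case of the two maximal holes h₁, h₂.
--
-- Fix a maximal hole h.  Order ℕ^d by the key  x ↦ (χₕ(x), x) ∈ ℕ^(1+d),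
-- compared lexicographically, where χₕ(x) = 1 if h ≤ x in the natural
-- order and 0 otherwise.

open import Defs
open import Data.Nat using (ℕ; _+_; _<_; _≤_; z≤n; s≤s; _≤?_)
open import Data.Nat.Properties using (m≤m+n; m≤n⇒m<n∨m≡n; ≤-refl; ≤-trans; <-isStrictTotalOrder)
open import Data.Vec using (Vec; []; _∷_)
open import Data.Vec.Properties using (∷-injectiveʳ)
open import Data.Vec.Relation.Binary.Pointwise.Inductive as Pointwise
  using (Pointwise; _∷_; []; Pointwise-≡⇒≡)
open import Data.Vec.Relation.Binary.Lex.Strict as Lex using (Lex-<; Lex-≤)
open import Data.Vec.Relation.Binary.Lex.Core using (this; next; base)
open import Data.Product using (_×_; _,_)
open import Data.Sum using (_⊎_; inj₁; inj₂)
open import Relation.Nullary using (¬_; yes; no; contradiction)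
open import Relation.Binary using (IsStrictTotalOrder; tri<; tri≈; tri>)
open import Relation.Binary.PropositionalEquality using (_≡_; _≢_; refl; sym)

≤ₙ-trans : ∀ {d} {x y z : Pt d} → x ≤ₙ y → y ≤ₙ z → x ≤ₙ z
≤ₙ-trans = Pointwise.trans ≤-trans

≤ₙ-⊕ : ∀ {d} (x u : Pt d) → x ≤ₙ (x ⊕ u)
≤ₙ-⊕ []      []      = []
≤ₙ-⊕ (a ∷ x) (b ∷ u) = m≤m+n a b ∷ ≤ₙ-⊕ x u

𝟎-≤ₙ : ∀ {d} (x : Pt d) → 𝟎 ≤ₙ x
𝟎-≤ₙ []      = []
𝟎-≤ₙ (_ ∷ x) = z≤n ∷ 𝟎-≤ₙ x

_<ₗ_ : ∀ {m} → Vec ℕ m → Vec ℕ m → Set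
_<ₗ_ = Lex-< _≡_ _<_

_≤ₗ_ : ∀ {m} → Vec ℕ m → Vec ℕ m → Set
_≤ₗ_ = Lex-≤ _≡_ _<_

<ₗ-isStrictTotalOrder : ∀ {m} → IsStrictTotalOrder (Pointwise _≡_ {m} {m}) _<ₗ_
<ₗ-isStrictTotalOrder = Lex.<-isStrictTotalOrder <-isStrictTotalOrder

module <ₗ {m : ℕ} = IsStrictTotalOrder (<ₗ-isStrictTotalOrder {m})
module <ℕ = IsStrictTotalOrder <-isStrictTotalOrder

<ₗ-≤ₗ-trans : ∀ {m} {x y z : Vec ℕ m} → x <ₗ y → y ≤ₗ z → x <ₗ z
<ₗ-≤ₗ-trans = Lex.<-transˡ <ℕ.Eq.isPartialEquivalence <ℕ.<-resp-≈ <ℕ.trans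

≤ₗ-<ₗ-trans : ∀ {m} {x y z : Vec ℕ m} → x ≤ₗ y → y <ₗ z → x <ₗ z
≤ₗ-<ₗ-trans = Lex.<-transʳ <ℕ.Eq.isPartialEquivalence <ℕ.<-resp-≈ <ℕ.trans

≤ₙ⇒≤ₗ : ∀ {m} {x y : Vec ℕ m} → x ≤ₙ y → x ≤ₗ y
≤ₙ⇒≤ₗ []       = base _
≤ₙ⇒≤ₗ (a≤b ∷ x≤y) with m≤n⇒m<n∨m≡n a≤b
... | inj₁ a<b = this a<b refl
... | inj₂ a≡b = next a≡b (≤ₙ⇒≤ₗ x≤y)

-- Pulling back the lexicographic order along a key  κ : ℕ^d → ℕ^m  that
-- is injective and monotone for the natural order yields a relaxed
-- monomial order: injectivity makes it total, and monotonicity gives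
-- both compatibility with addition and the minimality of 𝟎.
module KeyOrder {d m : ℕ} (κ : Pt d → Vec ℕ m)
                (κ-injective : ∀ {x y} → κ x ≡ κ y → x ≡ y)
                (κ-monotone : ∀ {x y} → x ≤ₙ y → κ x ≤ₙ κ y) where

  _≺_ : Pt d → Pt d → Set
  x ≺ y = κ x <ₗ κ y

  ≤ₙ⇒⊀ : ∀ {x y} → x ≤ₙ y → ¬ (y ≺ x)
  ≤ₙ⇒⊀ x≤y y≺x = <ₗ.irrefl (Pointwise.refl refl) (≤ₗ-<ₗ-trans (≤ₙ⇒≤ₗ (κ-monotone x≤y)) y≺x)

  compare : ∀ x y → x ≺ y ⊎ x ≡ y ⊎ y ≺ x
  compare x y with <ₗ.compare (κ x) (κ y)
  ... | tri< x≺y _ _ = inj₁ x≺y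
  ... | tri≈ _ κx≋κy _ = inj₂ (inj₁ (κ-injective (Pointwise-≡⇒≡ κx≋κy)))
  ... | tri> _ _ y≺x = inj₂ (inj₂ y≺x)

  isRelaxedMonomialOrder : IsRelaxedMonomialOrder _≺_
  isRelaxedMonomialOrder = record
    { irrefl = λ x → <ₗ.irrefl (Pointwise.refl refl)
    ; trans = λ _ _ _ → <ₗ.trans
    ; total = compare
    ; monotone = λ v w u v≺w → <ₗ-≤ₗ-trans v≺w (≤ₙ⇒≤ₗ (κ-monotone (≤ₙ-⊕ w u)))
    ; zero-least = 𝟎-least
    }
    where
    𝟎-least : ∀ v → v ≢ 𝟎 → 𝟎 ≺ v
    𝟎-least v v≢𝟎 with compare 𝟎 v
    ... | inj₁ 𝟎≺v = 𝟎≺v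
    ... | inj₂ (inj₁ 𝟎≡v) = contradiction (sym 𝟎≡v) v≢𝟎
    ... | inj₂ (inj₂ v≺𝟎) = contradiction v≺𝟎 (≤ₙ⇒⊀ (𝟎-≤ₙ v))

χ : ∀ {d} → Pt d → Pt d → ℕ
χ h x with Pointwise.decidable _≤?_ h x
... | yes _ = 1
... | no _  = 0

χ-above : ∀ {d} {h x : Pt d} → h ≤ₙ x → χ h x ≡ 1
χ-above {h = h} {x} h≤x with Pointwise.decidable _≤?_ h x
... | yes _   = refl
... | no h≰x = contradiction h≤x h≰x

χ-not-above : ∀ {d} {h x : Pt d} → ¬ (h ≤ₙ x) → χ h x ≡ 0
χ-not-above {h = h} {x} h≰x with Pointwise.decidable _≤?_ h x
... | yes h≤x = contradiction h≤x h≰x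
... | no _    = refl

χ-monotone : ∀ {d} (h : Pt d) {x y : Pt d} → x ≤ₙ y → χ h x ≤ χ h y
χ-monotone h {x} {y} x≤y with Pointwise.decidable _≤?_ h x
... | no _    = z≤n
... | yes h≤x rewrite χ-above (≤ₙ-trans h≤x x≤y) = ≤-refl

heightKey : ∀ {d} → Pt d → Pt d → Vec ℕ (1 + d)
heightKey h x = χ h x ∷ x

module HeightOrder {d : ℕ} (h : Pt d) =
  KeyOrder (heightKey h) ∷-injectiveʳ (λ x≤y → χ-monotone h x≤y ∷ x≤y)

-- A maximal hole h is the largest hole in the height order of h: every
-- other hole x lies outside the up-set of h, so χₕ(x) = 0 < 1 = χₕ(h).
maximalHole⇒allowable : ∀ {d} (S : Pt d → Set) (h : Pt d) → IsMaximalHole S h → FrobeniusAllowable S h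
maximalHole⇒allowable S h (h∉S , h-maximal) =
  h∉S , _≺_ , isRelaxedMonomialOrder , h∉S , h-largest
  where
  open HeightOrder h
  h-largest : ∀ x → Hole S x → x ≢ h → x ≺ h
  h-largest x x∉S x≢h
    rewrite χ-not-above {h = h} {x} (λ h≤x → x≢h (h-maximal x x∉S h≤x))
          | χ-above {h = h} (Pointwise.refl ≤-refl)
    = this (s≤s z≤n) refl

mainTheorem18 : (d : ℕ) (S : Pt d → Set) → IsGNS S → (h₁ h₂ : Pt d) →
    h₁ ≢ h₂ → IsMaximalHole S h₁ → IsMaximalHole S h₂ →
    (∀ h → IsMaximalHole S h → h ≡ h₁ ⊎ h ≡ h₂) →
    FrobeniusAllowable S h₁ × FrobeniusAllowable S h₂
mainTheorem18 d S _ h₁ h₂ _ h₁-maximal h₂-maximal _ =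
  maximalHole⇒allowable S h₁ h₁-maximal , maximalHole⇒allowable S h₂ h₂-maximal
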